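{- Each of the following classes of structures with one binary relation $R$ has superSAPU (with respect to $R$) and the joint embedding property: (a) partially ordered sets; (b) preordered sets; (c) undirected graphs (sets with a symmetric antireflexive binary relation); (d) directed graphs (sets with an antireflexive binary relation); (e) sets with an equivalence relation; (f) sets with a transitive binary relation; (g) sets with a symmetric reflexive binary relation. Moreover, for arbitrary sets $F,G$, superSAPU and JEP are maintained for each of these classes when one adds an $F$-indexed family of unary operations $f$ that are relation-preserving (i.e. $xRy$ implies $f(x)Rf(y)$) and a $G$-indexed family of unary operations $g$ that are relation-reversing (i.e. $xRy$ implies $g(y)Rg(x)$).
   Context: Structures are first-order structures; embeddings are injective maps preserving functions and constants and preserving and reflecting relations; $\mathbf A\subseteq\mathbf B$ means $A\subseteq B$ and inclusion is an embedding; classes are closed under isomorphism. A class $\mathcal K$ has superSAPU with respect to a binary relation symbol $R$ if whenever $\mathbf A,\mathbf B,\mathbf C\in\mathcal K$ with $\mathbf C\subseteq\mathbf A$, $\mathbf C\subseteq\mathbf B$, $C=A\cap B$, there is $\mathbf D\in\mathcal K$ with domain $D=A\cup B$, $\mathbf A\subseteq\mathbf D$, $\mathbf B\subseteq\mathbf D$, such that for all $a\in A\setminus B$, $b\in B\setminus A$: if $aR^{\mathbf D}b$ then $aR^{\mathbf A}cR^{\mathbf B}b$ for some $c\in C$, and if $bR^{\mathbf D}a$ then $bR^{\mathbf B}cR^{\mathbf A}a$ for some $c\in C$. $\mathcal K$ has the joint embedding property (JEP) if for all $\mathbf A,\mathbf B\in\mathcal K$ there are $\mathbf D\in\mathcal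 K$ and embeddings of $\mathbf A$ and of $\mathbf B$ into $\mathbf D$. -}

module Defs where

open import Data.Empty using (⊥)
open import Data.Product using (Σ; ∃; ∃-syntax; _×_; _,_)
open import Data.Sum using (_⊎_)
open import Relation.Nullary using (¬_)
open import Relation.Binary.Core using (Rel; _Preserves_⟶_)
open import Relation.Binary.Structures using (IsEquivalence)
open import Relation.Binary.Definitions using (_Respects₂_)

-- Carriers are setoids (Agda has no quotients); all notions below are
-- taken up to the carrier equality _≈_.

record Str (F G : Set) : Set₁ where
  field
    Carrier       : Set
    _≈_           : Rel Carrier _
    isEquivalence : IsEquivalence _≈_
    R             : Rel Carrier _
    R-resp        : R Respects₂ _≈_
    fop           : F → Carrier → Carrier
    gop           : G → Carrier → Carrier
    fop-cong      : ∀ i → fop i Preserves _≈_ ⟶ _≈_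
    gop-cong      : ∀ j → gop j Preserves _≈_ ⟶ _≈_

open Str public

record Emb {F G : Set} (A B : Str F G) : Set where
  field
    map     : Carrier A → Carrier B
    cong    : ∀ {x y} → _≈_ A x y → _≈_ B (map x) (map y)
    inj     : ∀ {x y} → _≈_ B (map x) (map y) → _≈_ A x y
    pres-f  : ∀ i x → _≈_ B (map (fop A i x)) (fop B i (map x))
    pres-g  : ∀ j x → _≈_ B (map (gop A j x)) (gop B j (map x))
    pres-R  : ∀ {x y} → R A x y → R B (map x) (map y)
    refl-R  : ∀ {x y} → R B (map x) (map y) → R A x y

open Emb public

data Kind : Set where
  poset preorder graph digraph equivalence transitive symReflexive : Kind

module _ {F G : Set} (A : Str F G) where
  private
    X = Carrier A
    _∼_ = R A
    _≐_ = _≈_ A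

  Reflexive′ : Set
  Reflexive′ = ∀ x → x ∼ x

  Irreflexive′ : Set
  Irreflexive′ = ∀ x → ¬ (x ∼ x)

  Symmetric′ : Set
  Symmetric′ = ∀ x y → x ∼ y → y ∼ x

  Transitive′ : Set
  Transitive′ = ∀ x y z → x ∼ y → y ∼ z → x ∼ z

  Antisymmetric′ : Set
  Antisymmetric′ = ∀ x y → x ∼ y → y ∼ x → x ≐ y

  Axioms : Kind → Set
  Axioms poset        = Reflexive′ × Antisymmetric′ × Transitive′
  Axioms preorder     = Reflexive′ × Transitive′
  Axioms graph        = Symmetric′ × Irreflexive′
  Axioms digraph      = Irreflexive′
  Axioms equivalence  = Reflexive′ × Symmetric′ × Transitive′
  Axioms transitive   = Transitive′
  Axioms symReflexive = Symmetric′ × Reflexive′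

  OpsOK : Set
  OpsOK = (∀ i x y → x ∼ y → fop A i x ∼ fop A i y)
        × (∀ j x y → x ∼ y → gop A j y ∼ gop A j x)

InClass : {F G : Set} → Kind → Str F G → Set
InClass k A = Axioms A k × OpsOK A

-- Set-theoretic formulation: C ⊆ A, C ⊆ B, C = A ∩ B, D on A ∪ B.
-- Rendered (closure under isomorphism) via embeddings e₁ : C → A,
-- e₂ : C → B and h₁ : A → D, h₂ : B → D such that h₁ ∘ e₁ = h₂ ∘ e₂,
-- D is covered by the images of h₁ and h₂, and the images of h₁ and h₂
-- meet exactly in the image of C.

SuperSAPU : {F G : Set} → (Str F G → Set) → Set₁
SuperSAPU {F} {G} K =
  (A B C : Str F G) → K A → K B → K C →
  (e₁ : Emb C A) (e₂ : Emb C B) →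
  Σ (Str F G) λ D → K D × Σ (Emb A D) λ h₁ → Σ (Emb B D) λ h₂ →
      (∀ c → _≈_ D (map h₁ (map e₁ c)) (map h₂ (map e₂ c)))
    × (∀ d → (∃[ a ] _≈_ D (map h₁ a) d) ⊎ (∃[ b ] _≈_ D (map h₂ b) d))
    × (∀ a b → _≈_ D (map h₁ a) (map h₂ b) →
          ∃[ c ] (_≈_ A a (map e₁ c) × _≈_ B b (map e₂ c)))
      -- the superSAPU condition for a ∈ A ∖ B, b ∈ B ∖ A
    × (∀ a b → ¬ (∃[ c ] _≈_ A a (map e₁ c)) → ¬ (∃[ c ] _≈_ B b (map e₂ c)) →
          (R D (map h₁ a) (map h₂ b) →
             ∃[ c ] (R A a (map e₁ c) × R B (map e₂ c) b))
        × (R D (map h₂ b) (map h₁ a) →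
             ∃[ c ] (R B b (map e₂ c) × R A (map e₁ c) a)))

JEP : {F G : Set} → (Str F G → Set) → Set₁
JEP {F} {G} K =
  (A B : Str F G) → K A → K B →
  Σ (Str F G) λ D → K D × Emb A D × Emb B D

{-# OPTIONS --safe #-}
module Submission where

-- Glue A and B along C: the points of the amalgam D are those of A ⊎ B, where a ∈ A and
-- b ∈ B are identified when both come from the same element of C.  The relation of D is
-- R^A ∪ R^B, and when A and B are transitive also R^A ∘ R^B ∪ R^B ∘ R^A.  The result is
-- transitive because an R^B-step between two points of A lies inside C, where R^B and R^A
-- agree (the embeddings reflect R); so every longer word in R^A, R^B collapses to length
-- at most two.  Each axiom, and the (anti)monotonicity of the operations, passes from A
-- and B to D, and an edge between A ∖ C and B ∖ C can only be a composite through C,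
-- which is the superSAPU condition.  JEP is amalgamation over the empty structure.

open import Defs
open import Data.Empty using (⊥; ⊥-elim)
open import Data.Product using (∃-syntax; _×_; _,_; proj₁; proj₂)
open import Data.Sum using (_⊎_; inj₁; inj₂; [_,_]′)
open import Data.Unit using (⊤; tt)
open import Relation.Nullary using (¬_)
open import Relation.Binary.Structures using (IsEquivalence)

R-respects : ∀ {F G} (S : Str F G) {s t s′ t′} →
             R S s t → _≈_ S s s′ → _≈_ S t t′ → R S s′ t′
R-respects S r p q = proj₁ (R-resp S) q (proj₂ (R-resp S) p r)

module Amalgam {F G : Set} (A B C : Str F G) (e₁ : Emb C A) (e₂ : Emb C B) where
  private
    module ≈A = IsEquivalence (isEquivalence A)
    module ≈B = IsEquivalence (isEquivalence B)

    _≈A_ : Carrier A → Carrier A → Set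
    _≈A_ = _≈_ A

    _≈B_ : Carrier B → Carrier B → Set
    _≈B_ = _≈_ B

  Point : Set
  Point = Carrier A ⊎ Carrier B

  Glued : Carrier A → Carrier B → Set
  Glued a b = ∃[ c ] (a ≈A map e₁ c × b ≈B map e₂ c)

  Glued-unique₁ : ∀ {a a′ b} → Glued a b → Glued a′ b → a ≈A a′
  Glued-unique₁ (_ , a≈ , b≈) (_ , a′≈ , b≈′) =
    ≈A.trans a≈ (≈A.trans (cong e₁ (inj e₂ (≈B.trans (≈B.sym b≈) b≈′))) (≈A.sym a′≈))

  Glued-unique₂ : ∀ {a b b′} → Glued a b → Glued a b′ → b ≈B b′
  Glued-unique₂ (_ , a≈ , b≈) (_ , a≈′ , b′≈) =
    ≈B.trans b≈ (≈B.trans (cong e₂ (inj e₁ (≈A.trans (≈A.sym a≈) a≈′))) (≈B.sym b′≈))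

  Glued-transfer₁ : ∀ {a a′ b b′} → Glued a b → Glued a′ b′ → R B b b′ → R A a a′
  Glued-transfer₁ (_ , a≈ , b≈) (_ , a′≈ , b′≈) r =
    R-respects A (pres-R e₁ (refl-R e₂ (R-respects B r b≈ b′≈))) (≈A.sym a≈) (≈A.sym a′≈)

  Glued-transfer₂ : ∀ {a a′ b b′} → Glued a b → Glued a′ b′ → R A a a′ → R B b b′
  Glued-transfer₂ (_ , a≈ , b≈) (_ , a′≈ , b′≈) r =
    R-respects B (pres-R e₂ (refl-R e₁ (R-respects A r a≈ a′≈))) (≈B.sym b≈) (≈B.sym b′≈)

  infix 4 _≈ᴰ_
  data _≈ᴰ_ : Point → Point → Set where
    ≈₁       : ∀ {a a′} → a ≈A a′ → inj₁ a ≈ᴰ inj₁ a′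
    ≈₂       : ∀ {b b′} → b ≈B b′ → inj₂ b ≈ᴰ inj₂ b′
    glued    : ∀ {a b} → Glued a b → inj₁ a ≈ᴰ inj₂ b
    glued⁻¹  : ∀ {a b} → Glued a b → inj₂ b ≈ᴰ inj₁ a

  ≈ᴰ-refl : ∀ {x} → x ≈ᴰ x
  ≈ᴰ-refl {inj₁ _} = ≈₁ ≈A.refl
  ≈ᴰ-refl {inj₂ _} = ≈₂ ≈B.refl

  ≈ᴰ-sym : ∀ {x y} → x ≈ᴰ y → y ≈ᴰ x
  ≈ᴰ-sym (≈₁ p)      = ≈₁ (≈A.sym p)
  ≈ᴰ-sym (≈₂ p)      = ≈₂ (≈B.sym p)
  ≈ᴰ-sym (glued g)   = glued⁻¹ g
  ≈ᴰ-sym (glued⁻¹ g) = glued g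

  ≈ᴰ-trans : ∀ {x y z} → x ≈ᴰ y → y ≈ᴰ z → x ≈ᴰ z
  ≈ᴰ-trans (≈₁ p)              (≈₁ q)              = ≈₁ (≈A.trans p q)
  ≈ᴰ-trans (≈₁ p)              (glued (c , q , r)) = glued (c , ≈A.trans p q , r)
  ≈ᴰ-trans (≈₂ p)              (≈₂ q)              = ≈₂ (≈B.trans p q)
  ≈ᴰ-trans (≈₂ p)              (glued⁻¹ (c , q , r)) = glued⁻¹ (c , q , ≈B.trans p r)
  ≈ᴰ-trans (glued g)           (glued⁻¹ h)         = ≈₁ (Glued-unique₁ g h)
  ≈ᴰ-trans (glued (c , p , q)) (≈₂ r)              = glued (c , p , ≈B.trans (≈B.sym r) q)
  ≈ᴰ-trans (glued⁻¹ g)         (glued h)           = ≈₂ (Glued-unique₂ g h)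
  ≈ᴰ-trans (glued⁻¹ (c , p , q)) (≈₁ r)            = glued⁻¹ (c , ≈A.trans (≈A.sym r) p , q)

  ≈ᴰ-isEquivalence : IsEquivalence _≈ᴰ_
  ≈ᴰ-isEquivalence = record { refl = ≈ᴰ-refl ; sym = ≈ᴰ-sym ; trans = ≈ᴰ-trans }

  glue-C : ∀ c → inj₁ (map e₁ c) ≈ᴰ inj₂ (map e₂ c)
  glue-C c = glued (c , ≈A.refl , ≈B.refl)

  covered : ∀ x → (∃[ a ] inj₁ a ≈ᴰ x) ⊎ (∃[ b ] inj₂ b ≈ᴰ x)
  covered (inj₁ a) = inj₁ (a , ≈ᴰ-refl)
  covered (inj₂ b) = inj₂ (b , ≈ᴰ-refl)

  liftOp : (Carrier A → Carrier A) → (Carrier B → Carrier B) → Point → Point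
  liftOp φ ψ (inj₁ a) = inj₁ (φ a)
  liftOp φ ψ (inj₂ b) = inj₂ (ψ b)

  liftOp-cong : ∀ {φ ψ} (χ : Carrier C → Carrier C) →
                (∀ {a a′} → a ≈A a′ → φ a ≈A φ a′) → (∀ {b b′} → b ≈B b′ → ψ b ≈B ψ b′) →
                (∀ c → map e₁ (χ c) ≈A φ (map e₁ c)) → (∀ c → map e₂ (χ c) ≈B ψ (map e₂ c)) →
                ∀ {x y} → x ≈ᴰ y → liftOp φ ψ x ≈ᴰ liftOp φ ψ y
  liftOp-cong {φ} {ψ} χ φ-cong ψ-cong e₁-χ e₂-χ = go
    where
    lift-Glued : ∀ {a b} → Glued a b → Glued (φ a) (ψ b)
    lift-Glued (c , a≈ , b≈) =
      χ c , ≈A.trans (φ-cong a≈) (≈A.sym (e₁-χ c)) , ≈B.trans (ψ-cong b≈) (≈B.sym (e₂-χ c))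

    go : ∀ {x y} → x ≈ᴰ y → liftOp φ ψ x ≈ᴰ liftOp φ ψ y
    go (≈₁ p)      = ≈₁ (φ-cong p)
    go (≈₂ p)      = ≈₂ (ψ-cong p)
    go (glued g)   = glued (lift-Glued g)
    go (glued⁻¹ g) = glued⁻¹ (lift-Glued g)

  fᴰ : F → Point → Point
  fᴰ i = liftOp (fop A i) (fop B i)

  gᴰ : G → Point → Point
  gᴰ j = liftOp (gop A j) (gop B j)

  fᴰ-cong : ∀ i {x y} → x ≈ᴰ y → fᴰ i x ≈ᴰ fᴰ i y
  fᴰ-cong i = liftOp-cong (fop C i) (fop-cong A i) (fop-cong B i) (pres-f e₁ i) (pres-f e₂ i)

  gᴰ-cong : ∀ j {x y} → x ≈ᴰ y → gᴰ j x ≈ᴰ gᴰ j y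
  gᴰ-cong j = liftOp-cong (gop C j) (gop-cong A j) (gop-cong B j) (pres-g e₁ j) (pres-g e₂ j)

  module Pushforward (S : Str F G) (ι : Carrier S → Point)
                     (ι-cong : ∀ {s s′} → _≈_ S s s′ → ι s ≈ᴰ ι s′)
                     (ι-injective : ∀ {s s′} → ι s ≈ᴰ ι s′ → _≈_ S s s′)
                     (ι-fᴰ : ∀ i s → fᴰ i (ι s) ≈ᴰ ι (fop S i s))
                     (ι-gᴰ : ∀ j s → gᴰ j (ι s) ≈ᴰ ι (gop S j s)) where
    Over : Point → Set
    Over x = ∃[ s ] x ≈ᴰ ι s

    Over-resp : ∀ {x y} → x ≈ᴰ y → Over y → Over x
    Over-resp x≈ (s , p) = s , ≈ᴰ-trans x≈ p

    infix 4 _∼_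
    data _∼_ (x y : Point) : Set where
      pushed : ∀ {s s′} → x ≈ᴰ ι s → y ≈ᴰ ι s′ → R S s s′ → x ∼ y

    source : ∀ {x y} → x ∼ y → Over x
    source (pushed p _ _) = _ , p

    target : ∀ {x y} → x ∼ y → Over y
    target (pushed _ q _) = _ , q

    ∼-resp : ∀ {x y x′ y′} → x ∼ y → x ≈ᴰ x′ → y ≈ᴰ y′ → x′ ∼ y′
    ∼-resp (pushed p q r) x≈ y≈ = pushed (≈ᴰ-trans (≈ᴰ-sym x≈) p) (≈ᴰ-trans (≈ᴰ-sym y≈) q) r

    reflect : ∀ {x y s s′} → x ∼ y → x ≈ᴰ ι s → y ≈ᴰ ι s′ → R S s s′
    reflect (pushed p q r) p′ q′ =
      R-respects S r (ι-injective (≈ᴰ-trans (≈ᴰ-sym p) p′)) (ι-injective (≈ᴰ-trans (≈ᴰ-sym q) q′))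

    ∼-trans : Transitive′ S → ∀ {x y z} → x ∼ y → y ∼ z → x ∼ z
    ∼-trans tS (pushed p q r) u@(pushed _ q′ _) = pushed p q′ (tS _ _ _ r (reflect u q q′))

    ∼-sym : Symmetric′ S → ∀ {x y} → x ∼ y → y ∼ x
    ∼-sym sS (pushed p q r) = pushed q p (sS _ _ r)

    ∼-irrefl : Irreflexive′ S → ∀ {x} → ¬ x ∼ x
    ∼-irrefl iS u@(pushed p _ _) = iS _ (reflect u p p)

    ∼-antisym : Antisymmetric′ S → ∀ {x y} → x ∼ y → y ∼ x → x ≈ᴰ y
    ∼-antisym aS (pushed p q r) u =
      ≈ᴰ-trans p (≈ᴰ-trans (ι-cong (aS _ _ r (reflect u q p))) (≈ᴰ-sym q))

    ι-∼ : ∀ {s s′} → R S s s′ → ι s ∼ ι s′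
    ι-∼ = pushed ≈ᴰ-refl ≈ᴰ-refl

    fᴰ-mono : OpsOK S → ∀ i {x y} → x ∼ y → fᴰ i x ∼ fᴰ i y
    fᴰ-mono ops i (pushed p q r) =
      pushed (≈ᴰ-trans (fᴰ-cong i p) (ι-fᴰ i _)) (≈ᴰ-trans (fᴰ-cong i q) (ι-fᴰ i _)) (proj₁ ops i _ _ r)

    gᴰ-anti : OpsOK S → ∀ j {x y} → x ∼ y → gᴰ j y ∼ gᴰ j x
    gᴰ-anti ops j (pushed p q r) =
      pushed (≈ᴰ-trans (gᴰ-cong j q) (ι-gᴰ j _)) (≈ᴰ-trans (gᴰ-cong j p) (ι-gᴰ j _)) (proj₂ ops j _ _ r)

  private
    inj₁-injective : ∀ {a a′} → inj₁ a ≈ᴰ inj₁ a′ → a ≈A a′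
    inj₁-injective (≈₁ p) = p

    inj₂-injective : ∀ {b b′} → inj₂ b ≈ᴰ inj₂ b′ → b ≈B b′
    inj₂-injective (≈₂ p) = p

  module Aᴰ = Pushforward A inj₁ ≈₁ inj₁-injective (λ _ _ → ≈ᴰ-refl) (λ _ _ → ≈ᴰ-refl)
  module Bᴰ = Pushforward B inj₂ ≈₂ inj₂-injective (λ _ _ → ≈ᴰ-refl) (λ _ _ → ≈ᴰ-refl)

  Over-both : ∀ {x} → Aᴰ.Over x → Bᴰ.Over x → ∃[ c ] (x ≈ᴰ inj₁ (map e₁ c) × x ≈ᴰ inj₂ (map e₂ c))
  Over-both (_ , p) (_ , q) with ≈ᴰ-trans (≈ᴰ-sym p) q
  ... | glued (c , a≈ , b≈) = c , ≈ᴰ-trans p (≈₁ a≈) , ≈ᴰ-trans q (≈₂ b≈)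

  Bᴰ⊆Aᴰ : ∀ {x y} → x Bᴰ.∼ y → Aᴰ.Over x → Aᴰ.Over y → x Aᴰ.∼ y
  Bᴰ⊆Aᴰ (Bᴰ.pushed p q r) (_ , p′) (_ , q′)
    with ≈ᴰ-trans (≈ᴰ-sym p′) p | ≈ᴰ-trans (≈ᴰ-sym q′) q
  ... | glued g | glued h = Aᴰ.pushed p′ q′ (Glued-transfer₁ g h r)

  Aᴰ⊆Bᴰ : ∀ {x y} → x Aᴰ.∼ y → Bᴰ.Over x → Bᴰ.Over y → x Bᴰ.∼ y
  Aᴰ⊆Bᴰ (Aᴰ.pushed p q r) (_ , p′) (_ , q′)
    with ≈ᴰ-trans (≈ᴰ-sym p) p′ | ≈ᴰ-trans (≈ᴰ-sym q) q′
  ... | glued g | glued h = Bᴰ.pushed p′ q′ (Glued-transfer₂ g h r)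

  BothTransitive : Set
  BothTransitive = Transitive′ A × Transitive′ B

  -- The composite steps exist only when A and B are both transitive (they carry the proof);
  -- then _Rᴰ_ is the transitive closure of R^A ∪ R^B, otherwise it is the union itself.
  infix 4 _Rᴰ_
  data _Rᴰ_ (x y : Point) : Set where
    inA  : x Aᴰ.∼ y → x Rᴰ y
    inB  : x Bᴰ.∼ y → x Rᴰ y
    inAB : ∀ {z} → BothTransitive → x Aᴰ.∼ z → z Bᴰ.∼ y → x Rᴰ y
    inBA : ∀ {z} → BothTransitive → x Bᴰ.∼ z → z Aᴰ.∼ y → x Rᴰ y

  Rᴰ-resp : ∀ {x y x′ y′} → x Rᴰ y → x ≈ᴰ x′ → y ≈ᴰ y′ → x′ Rᴰ y′
  Rᴰ-resp (inA r)      x≈ y≈ = inA (Aᴰ.∼-resp r x≈ y≈)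
  Rᴰ-resp (inB r)      x≈ y≈ = inB (Bᴰ.∼-resp r x≈ y≈)
  Rᴰ-resp (inAB t r s) x≈ y≈ = inAB t (Aᴰ.∼-resp r x≈ ≈ᴰ-refl) (Bᴰ.∼-resp s ≈ᴰ-refl y≈)
  Rᴰ-resp (inBA t r s) x≈ y≈ = inBA t (Bᴰ.∼-resp r x≈ ≈ᴰ-refl) (Aᴰ.∼-resp s ≈ᴰ-refl y≈)

  D : Str F G
  D = record
    { Carrier       = Point
    ; _≈_           = _≈ᴰ_
    ; isEquivalence = ≈ᴰ-isEquivalence
    ; R             = _Rᴰ_
    ; R-resp        = (λ y≈ u → Rᴰ-resp u ≈ᴰ-refl y≈) , (λ x≈ u → Rᴰ-resp u x≈ ≈ᴰ-refl)
    ; fop           = fᴰ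
    ; gop           = gᴰ
    ; fop-cong      = fᴰ-cong
    ; gop-cong      = gᴰ-cong
    }

  Rᴰ⊆Aᴰ : ∀ {x y} → x Rᴰ y → Aᴰ.Over x → Aᴰ.Over y → x Aᴰ.∼ y
  Rᴰ⊆Aᴰ (inA r)             _  _  = r
  Rᴰ⊆Aᴰ (inB r)             ox oy = Bᴰ⊆Aᴰ r ox oy
  Rᴰ⊆Aᴰ (inAB (tA , _) r s) _  oy = Aᴰ.∼-trans tA r (Bᴰ⊆Aᴰ s (Aᴰ.target r) oy)
  Rᴰ⊆Aᴰ (inBA (tA , _) r s) ox _  = Aᴰ.∼-trans tA (Bᴰ⊆Aᴰ r ox (Aᴰ.source s)) s

  Rᴰ⊆Bᴰ : ∀ {x y} → x Rᴰ y → Bᴰ.Over x → Bᴰ.Over y → x Bᴰ.∼ y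
  Rᴰ⊆Bᴰ (inA r)             ox oy = Aᴰ⊆Bᴰ r ox oy
  Rᴰ⊆Bᴰ (inB r)             _  _  = r
  Rᴰ⊆Bᴰ (inAB (_ , tB) r s) ox _  = Bᴰ.∼-trans tB (Aᴰ⊆Bᴰ r ox (Bᴰ.source s)) s
  Rᴰ⊆Bᴰ (inBA (_ , tB) r s) _  oy = Bᴰ.∼-trans tB r (Aᴰ⊆Bᴰ s (Bᴰ.target r) oy)

  Rᴰ-source : ∀ {x y} → x Rᴰ y → Aᴰ.Over x ⊎ Bᴰ.Over x
  Rᴰ-source (inA r)      = inj₁ (Aᴰ.source r)
  Rᴰ-source (inB r)      = inj₂ (Bᴰ.source r)
  Rᴰ-source (inAB _ r _) = inj₁ (Aᴰ.source r)
  Rᴰ-source (inBA _ r _) = inj₂ (Bᴰ.source r)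

  Rᴰ-trans : BothTransitive → Transitive′ D
  Rᴰ-trans t@(tA , tB) _ _ _ = go
    where
    _⨾A_ : ∀ {x y z} → x Aᴰ.∼ y → y Aᴰ.∼ z → x Aᴰ.∼ z
    _⨾A_ = Aᴰ.∼-trans tA

    _⨾B_ : ∀ {x y z} → x Bᴰ.∼ y → y Bᴰ.∼ z → x Bᴰ.∼ z
    _⨾B_ = Bᴰ.∼-trans tB

    ABA : ∀ {x y z w} → x Aᴰ.∼ y → y Bᴰ.∼ z → z Aᴰ.∼ w → x Aᴰ.∼ w
    ABA r s u = r ⨾A (Bᴰ⊆Aᴰ s (Aᴰ.target r) (Aᴰ.source u) ⨾A u)

    BAB : ∀ {x y z w} → x Bᴰ.∼ y → y Aᴰ.∼ z → z Bᴰ.∼ w → x Bᴰ.∼ w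
    BAB r s u = r ⨾B (Aᴰ⊆Bᴰ s (Bᴰ.target r) (Bᴰ.source u) ⨾B u)

    go : ∀ {x y z} → x Rᴰ y → y Rᴰ z → x Rᴰ z
    go (inA r)       (inA s)       = inA (r ⨾A s)
    go (inA r)       (inB s)       = inAB t r s
    go (inA r)       (inAB _ s s′) = inAB t (r ⨾A s) s′
    go (inA r)       (inBA _ s s′) = inA (ABA r s s′)
    go (inB r)       (inA s)       = inBA t r s
    go (inB r)       (inB s)       = inB (r ⨾B s)
    go (inB r)       (inAB _ s s′) = inB (BAB r s s′)
    go (inB r)       (inBA _ s s′) = inBA t (r ⨾B s) s′
    go (inAB _ r r′) (inA s)       = inA (ABA r r′ s)
    go (inAB _ r r′) (inB s)       = inAB t r (r′ ⨾B s)
    go (inAB _ r r′) (inAB _ s s′) = inAB t (ABA r r′ s) s′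
    go (inAB _ r r′) (inBA _ s s′) = inA (ABA r (r′ ⨾B s) s′)
    go (inBA _ r r′) (inA s)       = inBA t r (r′ ⨾A s)
    go (inBA _ r r′) (inB s)       = inB (BAB r r′ s)
    go (inBA _ r r′) (inAB _ s s′) = inB (BAB r (r′ ⨾A s) s′)
    go (inBA _ r r′) (inBA _ s s′) = inBA t r (ABA r′ s s′)

  Rᴰ-refl : Reflexive′ A → Reflexive′ B → Reflexive′ D
  Rᴰ-refl rA rB (inj₁ a) = inA (Aᴰ.ι-∼ (rA a))
  Rᴰ-refl rA rB (inj₂ b) = inB (Bᴰ.ι-∼ (rB b))

  Rᴰ-sym : Symmetric′ A → Symmetric′ B → Symmetric′ D
  Rᴰ-sym sA sB _ _ (inA r)      = inA (Aᴰ.∼-sym sA r)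
  Rᴰ-sym sA sB _ _ (inB r)      = inB (Bᴰ.∼-sym sB r)
  Rᴰ-sym sA sB _ _ (inAB t r s) = inBA t (Bᴰ.∼-sym sB s) (Aᴰ.∼-sym sA r)
  Rᴰ-sym sA sB _ _ (inBA t r s) = inAB t (Aᴰ.∼-sym sA s) (Bᴰ.∼-sym sB r)

  Rᴰ-irrefl : Irreflexive′ A → Irreflexive′ B → Irreflexive′ D
  Rᴰ-irrefl iA iB _ u =
    [ (λ ox → Aᴰ.∼-irrefl iA (Rᴰ⊆Aᴰ u ox ox)) , (λ ox → Bᴰ.∼-irrefl iB (Rᴰ⊆Bᴰ u ox ox)) ]′ (Rᴰ-source u)

  SameSide : Point → Point → Set
  SameSide x y = (Aᴰ.Over x × Aᴰ.Over y) ⊎ (Bᴰ.Over x × Bᴰ.Over y)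

  -- Only a cycle x → w → y → z → x that changes sides at both w and z is delicate; there
  -- antisymmetry identifies x with the point w of C.
  Rᴰ-cycle-same-side : Antisymmetric′ A → Antisymmetric′ B →
                       ∀ {x y} → x Rᴰ y → y Rᴰ x → SameSide x y
  Rᴰ-cycle-same-side _ _ (inA r)       _             = inj₁ (Aᴰ.source r , Aᴰ.target r)
  Rᴰ-cycle-same-side _ _ (inB r)       _             = inj₂ (Bᴰ.source r , Bᴰ.target r)
  Rᴰ-cycle-same-side _ _ (inAB _ r _)  (inA s)       = inj₁ (Aᴰ.source r , Aᴰ.source s)
  Rᴰ-cycle-same-side _ _ (inAB _ _ r′) (inB s)       = inj₂ (Bᴰ.target s , Bᴰ.target r′)
  Rᴰ-cycle-same-side _ _ (inAB _ r _)  (inAB _ s _)  = inj₁ (Aᴰ.source r , Aᴰ.source s)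
  Rᴰ-cycle-same-side aA _ (inAB t r r′) (inBA _ s s′) =
    inj₂ (Bᴰ.Over-resp x≈w (Bᴰ.source r′) , Bᴰ.target r′)
    where
    w∼x = Rᴰ⊆Aᴰ (Rᴰ-trans t _ _ _ (inB r′) (inBA t s s′)) (Aᴰ.target r) (Aᴰ.source r)
    x≈w = Aᴰ.∼-antisym aA r w∼x
  Rᴰ-cycle-same-side _ _ (inBA _ _ r′) (inA s)       = inj₁ (Aᴰ.target s , Aᴰ.target r′)
  Rᴰ-cycle-same-side _ _ (inBA _ r _)  (inB s)       = inj₂ (Bᴰ.source r , Bᴰ.source s)
  Rᴰ-cycle-same-side _ aB (inBA t r r′) (inAB _ s s′) =
    inj₁ (Aᴰ.Over-resp x≈w (Aᴰ.source r′) , Aᴰ.target r′)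
    where
    w∼x = Rᴰ⊆Bᴰ (Rᴰ-trans t _ _ _ (inA r′) (inAB t s s′)) (Bᴰ.target r) (Bᴰ.source r)
    x≈w = Bᴰ.∼-antisym aB r w∼x
  Rᴰ-cycle-same-side _ _ (inBA _ r _)  (inBA _ s _)  = inj₂ (Bᴰ.source r , Bᴰ.source s)

  Rᴰ-antisym : Antisymmetric′ A → Antisymmetric′ B → Antisymmetric′ D
  Rᴰ-antisym aA aB _ _ u v =
    [ (λ (ox , oy) → Aᴰ.∼-antisym aA (Rᴰ⊆Aᴰ u ox oy) (Rᴰ⊆Aᴰ v oy ox))
    , (λ (ox , oy) → Bᴰ.∼-antisym aB (Rᴰ⊆Bᴰ u ox oy) (Rᴰ⊆Bᴰ v oy ox))
    ]′ (Rᴰ-cycle-same-side aA aB u v)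

  Rᴰ-axioms : ∀ k → Axioms A k → Axioms B k → Axioms D k
  Rᴰ-axioms poset        (rA , aA , tA) (rB , aB , tB) = Rᴰ-refl rA rB , Rᴰ-antisym aA aB , Rᴰ-trans (tA , tB)
  Rᴰ-axioms preorder     (rA , tA)      (rB , tB)      = Rᴰ-refl rA rB , Rᴰ-trans (tA , tB)
  Rᴰ-axioms graph        (sA , iA)      (sB , iB)      = Rᴰ-sym sA sB , Rᴰ-irrefl iA iB
  Rᴰ-axioms digraph      iA             iB             = Rᴰ-irrefl iA iB
  Rᴰ-axioms equivalence  (rA , sA , tA) (rB , sB , tB) = Rᴰ-refl rA rB , Rᴰ-sym sA sB , Rᴰ-trans (tA , tB)
  Rᴰ-axioms transitive   tA             tB             = Rᴰ-trans (tA , tB)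
  Rᴰ-axioms symReflexive (sA , rA)      (sB , rB)      = Rᴰ-sym sA sB , Rᴰ-refl rA rB

  Rᴰ-ops : OpsOK A → OpsOK B → OpsOK D
  Rᴰ-ops opsA opsB = mono , anti
    where
    mono : ∀ i x y → x Rᴰ y → fᴰ i x Rᴰ fᴰ i y
    mono i _ _ (inA r)      = inA (Aᴰ.fᴰ-mono opsA i r)
    mono i _ _ (inB r)      = inB (Bᴰ.fᴰ-mono opsB i r)
    mono i _ _ (inAB t r s) = inAB t (Aᴰ.fᴰ-mono opsA i r) (Bᴰ.fᴰ-mono opsB i s)
    mono i _ _ (inBA t r s) = inBA t (Bᴰ.fᴰ-mono opsB i r) (Aᴰ.fᴰ-mono opsA i s)

    anti : ∀ j x y → x Rᴰ y → gᴰ j y Rᴰ gᴰ j x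
    anti j _ _ (inA r)      = inA (Aᴰ.gᴰ-anti opsA j r)
    anti j _ _ (inB r)      = inB (Bᴰ.gᴰ-anti opsB j r)
    anti j _ _ (inAB t r s) = inBA t (Bᴰ.gᴰ-anti opsB j s) (Aᴰ.gᴰ-anti opsA j r)
    anti j _ _ (inBA t r s) = inAB t (Aᴰ.gᴰ-anti opsA j s) (Bᴰ.gᴰ-anti opsB j r)

  inclusion₁ : Emb A D
  inclusion₁ = record
    { map    = inj₁
    ; cong   = ≈₁
    ; inj    = inj₁-injective
    ; pres-f = λ _ _ → ≈ᴰ-refl
    ; pres-g = λ _ _ → ≈ᴰ-refl
    ; pres-R = λ r → inA (Aᴰ.ι-∼ r)
    ; refl-R = λ u → Aᴰ.reflect (Rᴰ⊆Aᴰ u (_ , ≈ᴰ-refl) (_ , ≈ᴰ-refl)) ≈ᴰ-refl ≈ᴰ-refl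
    }

  inclusion₂ : Emb B D
  inclusion₂ = record
    { map    = inj₂
    ; cong   = ≈₂
    ; inj    = inj₂-injective
    ; pres-f = λ _ _ → ≈ᴰ-refl
    ; pres-g = λ _ _ → ≈ᴰ-refl
    ; pres-R = λ r → inB (Bᴰ.ι-∼ r)
    ; refl-R = λ u → Bᴰ.reflect (Rᴰ⊆Bᴰ u (_ , ≈ᴰ-refl) (_ , ≈ᴰ-refl)) ≈ᴰ-refl ≈ᴰ-refl
    }

  across₁₂ : ∀ {a b} → ¬ (∃[ c ] a ≈A map e₁ c) → ¬ (∃[ c ] b ≈B map e₂ c) →
             inj₁ a Rᴰ inj₂ b → ∃[ c ] (R A a (map e₁ c) × R B (map e₂ c) b)
  across₁₂ _   b∉C (inA (Aᴰ.pushed _ (glued⁻¹ (c , _ , b≈)) _)) = ⊥-elim (b∉C (c , b≈))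
  across₁₂ a∉C _   (inB (Bᴰ.pushed (glued (c , a≈ , _)) _ _)) = ⊥-elim (a∉C (c , a≈))
  across₁₂ _   _   (inAB _ r s) =
    let c , z≈₁ , z≈₂ = Over-both (Aᴰ.target r) (Bᴰ.source s)
    in  c , Aᴰ.reflect r ≈ᴰ-refl z≈₁ , Bᴰ.reflect s z≈₂ ≈ᴰ-refl
  across₁₂ a∉C _   (inBA _ (Bᴰ.pushed (glued (c , a≈ , _)) _ _) _) = ⊥-elim (a∉C (c , a≈))

  across₂₁ : ∀ {a b} → ¬ (∃[ c ] a ≈A map e₁ c) → ¬ (∃[ c ] b ≈B map e₂ c) →
             inj₂ b Rᴰ inj₁ a → ∃[ c ] (R B b (map e₂ c) × R A (map e₁ c) a)
  across₂₁ _   b∉C (inA (Aᴰ.pushed (glued⁻¹ (c , _ , b≈)) _ _)) = ⊥-elim (b∉C (c , b≈))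
  across₂₁ a∉C _   (inB (Bᴰ.pushed _ (glued (c , a≈ , _)) _)) = ⊥-elim (a∉C (c , a≈))
  across₂₁ _   b∉C (inAB _ (Aᴰ.pushed (glued⁻¹ (c , _ , b≈)) _ _) _) = ⊥-elim (b∉C (c , b≈))
  across₂₁ _   _   (inBA _ r s) =
    let c , z≈₁ , z≈₂ = Over-both (Aᴰ.source s) (Bᴰ.target r)
    in  c , Bᴰ.reflect r ≈ᴰ-refl z≈₂ , Aᴰ.reflect s z≈₁ ≈ᴰ-refl

superSAPU : ∀ {F G} k → SuperSAPU (InClass {F} {G} k)
superSAPU k A B C (axA , opsA) (axB , opsB) _ e₁ e₂ =
  D , (Rᴰ-axioms k axA axB , Rᴰ-ops opsA opsB) , inclusion₁ , inclusion₂ ,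
  glue-C , covered , (λ { _ _ (glued g) → g }) ,
  (λ _ _ a∉C b∉C → across₁₂ a∉C b∉C , across₂₁ a∉C b∉C)
  where open Amalgam A B C e₁ e₂

Empty : (F G : Set) → Str F G
Empty F G = record
  { Carrier       = ⊥
  ; _≈_           = λ _ _ → ⊤
  ; isEquivalence = record { refl = tt ; sym = λ _ → tt ; trans = λ _ _ → tt }
  ; R             = λ _ _ → ⊥
  ; R-resp        = (λ _ r → r) , (λ _ r → r)
  ; fop           = λ _ ()
  ; gop           = λ _ ()
  ; fop-cong      = λ _ {x} → ⊥-elim x
  ; gop-cong      = λ _ {x} → ⊥-elim x
  }

Empty-InClass : ∀ {F G} k → InClass k (Empty F G)
Empty-InClass poset        = ((λ ()) , (λ ()) , (λ ())) , (λ _ ()) , (λ _ ())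
Empty-InClass preorder     = ((λ ()) , (λ ())) , (λ _ ()) , (λ _ ())
Empty-InClass graph        = ((λ ()) , (λ ())) , (λ _ ()) , (λ _ ())
Empty-InClass digraph      = (λ ()) , (λ _ ()) , (λ _ ())
Empty-InClass equivalence  = ((λ ()) , (λ ()) , (λ ())) , (λ _ ()) , (λ _ ())
Empty-InClass transitive   = (λ ()) , (λ _ ()) , (λ _ ())
Empty-InClass symReflexive = ((λ ()) , (λ ())) , (λ _ ()) , (λ _ ())

Empty-initial : ∀ {F G} (A : Str F G) → Emb (Empty F G) A
Empty-initial A = record
  { map    = λ ()
  ; cong   = λ {x} → ⊥-elim x
  ; inj    = λ {x} → ⊥-elim x
  ; pres-f = λ _ ()
  ; pres-g = λ _ ()
  ; pres-R = λ ()
  ; refl-R = λ {x} → ⊥-elim x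
  }

jep : ∀ {F G} k → JEP (InClass {F} {G} k)
jep {F} {G} k A B inA inB =
  let D , inD , h₁ , h₂ , _ =
        superSAPU k A B (Empty F G) inA inB (Empty-InClass k) (Empty-initial A) (Empty-initial B)
  in  D , inD , h₁ , h₂

corollary3p3 : (F G : Set) (k : Kind) →
    SuperSAPU (InClass {F} {G} k) × JEP (InClass {F} {G} k)
corollary3p3 F G k = superSAPU k , jep k
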